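{- Let $m,n$ be positive integers and let $\mathcal{A}$ and $\mathcal{B}$ be intervals of residue classes modulo $m$ and $n$, respectively. Let $g=\gcd(m,n)$, and let $h$ denote the number of solutions modulo $mn/g$ of the linear system \[ x\equiv a \pmod m,\qquad x\equiv b\pmod n \] as $(a,b)$ ranges over $\mathcal{A}\times\mathcal{B}$, i.e. $h$ is the number of residue classes $x$ modulo $mn/g$ with $x\bmod m\in\mathcal{A}$ and $x\bmod n\in\mathcal{B}$. Write \[ |\mathcal{A}|=Ag+r_A,\quad 0\le r_A<g,\qquad |\mathcal{B}|=Bg+r_B,\quad 0\le r_B<g, \] with $A,B$ non-negative integers. Then \[ h\ge ABg+Ar_B+Br_A+\max(0,r_A+r_B-g). \]
   Context: An interval of residue classes modulo $m$ is a set of the form $\{c,c+1,\ldots,c+L-1\}\bmod m\subseteq\mathbb{Z}/m\mathbb{Z}$ for some integer $c$ and some integer $0\le L\le m$ (consecutive residues, taken cyclically); its size is $L$. The integers $A,B$ in the claim are distinct from the sets $\mathcal{A},\mathcal{B}$. -}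

module Defs where

open import Data.Nat using (ℕ; zero; suc; _+_; _*_; _∸_; _<_; _≤_; NonZero; _≟_; ≢-nonZero; ≢-nonZero⁻¹)
open import Data.Nat.DivMod using (_/_; _%_)
open import Data.Nat.GCD using (gcd; gcd[m,n]≢0)
open import Data.Bool.Properties using (T?)
open import Data.Bool using (Bool; _∧_)
open import Data.List using (List; upTo; filter; length)
open import Data.Bool.ListAction using (any)
open import Data.Sum using (inj₁)
open import Relation.Nullary.Decidable using (does)

gcd-nonZero : ∀ m n .{{_ : NonZero m}} → NonZero (gcd m n)
gcd-nonZero m n {{nz}} = ≢-nonZero (gcd[m,n]≢0 m n (inj₁ (≢-nonZero⁻¹ m {{nz}})))

-- The interval of residue classes {c, c+1, ..., c+L-1} mod m (cyclic), as a
-- decidable membership test: residue r belongs iff r ≡ (c + i) mod m for some i < L.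
inInterval : (m : ℕ) .{{_ : NonZero m}} → (c L r : ℕ) → Bool
inInterval m c L r = any (λ i → does (((c + i) % m) ≟ (r % m))) (upTo L)

countSolutions : (m n : ℕ) .{{_ : NonZero m}} .{{_ : NonZero n}} →
                 (c₁ L₁ c₂ L₂ : ℕ) → ℕ
countSolutions m n c₁ L₁ c₂ L₂ =
  length (filter (λ x → T? (inInterval m c₁ L₁ x ∧ inInterval n c₂ L₂ x))
                 (upTo ((m * n) / gcd m n)))
  where instance _ = gcd-nonZero m n

module Submission where

-- Since L₁ ≤ m, every x is hit by at most one i < L₁ with c₁+i ≡ x
-- (mod m), and similarly for n.  Hence h is at least the number of triples
-- (x, i, j) with x ≡ c₁+i (mod m) and x ≡ c₂+j (mod n).  By the Chinese
-- remainder theorem each pair (i, j) with c₁+i ≡ c₂+j (mod g) contributes at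
-- least one such x < M, so h is at least the number of "congruent pairs"
-- (i, j) ∈ [0,L₁) × [0,L₂).  Each block of g consecutive columns holds exactly
-- one congruent pair per row (and dually for rows), so outside the final
-- r_A × r_B corner there are exactly L₁ B + r_B A of them; in the corner, the
-- r_A rows completed to g columns hold r_A pairs, at most g - r_B of which lie
-- outside the corner, leaving at least r_A + r_B - g.

open import Data.Nat using (ℕ; zero; suc; _+_; _*_; _∸_; _<_; _≤_; _⊔_; NonZero; z≤n; s≤s; z<s; _≟_; >-nonZero)
open import Data.Nat.Properties
open import Data.Nat.DivMod
open import Data.Nat.Divisibility using (_∣_; divides; m∣m*n; ∣⇒≤)
open import Data.Nat.GCD using (gcd; gcd-GCD; gcd[m,n]∣m; gcd[m,n]∣n; module Bézout)
open import Data.Nat.Tactic.RingSolver using (solve-∀)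
open import Data.Bool using (Bool; true; false; _∧_)
open import Data.Bool.Properties using (T?)
open import Data.Bool.ListAction using (any)
open import Data.List using (length; filter; applyUpTo)
open import Data.Product using (_×_; _,_; ∃-syntax)
open import Relation.Binary.PropositionalEquality
open import Relation.Nullary using (¬_; yes; no)
open import Relation.Nullary.Decidable using (does; dec-true; dec-false)
open import Defs

Σ : ℕ → (ℕ → ℕ) → ℕ
Σ zero    f = 0
Σ (suc n) f = f 0 + Σ n (λ i → f (suc i))

Σ-cong : ∀ n {f g : ℕ → ℕ} → (∀ i → i < n → f i ≡ g i) → Σ n f ≡ Σ n g
Σ-cong zero    f≡g = refl
Σ-cong (suc n) f≡g = cong₂ _+_ (f≡g 0 z<s) (Σ-cong n (λ i i<n → f≡g (suc i) (s≤s i<n)))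

Σ-mono : ∀ n {f g : ℕ → ℕ} → (∀ i → i < n → f i ≤ g i) → Σ n f ≤ Σ n g
Σ-mono zero    f≤g = z≤n
Σ-mono (suc n) f≤g = +-mono-≤ (f≤g 0 z<s) (Σ-mono n (λ i i<n → f≤g (suc i) (s≤s i<n)))

Σ-split : ∀ a b f → Σ (a + b) f ≡ Σ a f + Σ b (λ i → f (a + i))
Σ-split zero    b f = refl
Σ-split (suc a) b f = trans (cong (f 0 +_) (Σ-split a b (λ i → f (suc i)))) (sym (+-assoc (f 0) _ _))

Σ-zero : ∀ n → Σ n (λ _ → 0) ≡ 0
Σ-zero zero    = refl
Σ-zero (suc n) = Σ-zero n

Σ-const : ∀ n c → Σ n (λ _ → c) ≡ n * c
Σ-const zero    c = refl
Σ-const (suc n) c = cong (c +_) (Σ-const n c)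

Σ-+ : ∀ n f g → Σ n (λ i → f i + g i) ≡ Σ n f + Σ n g
Σ-+ zero    f g = refl
Σ-+ (suc n) f g = trans (cong (f 0 + g 0 +_) (Σ-+ n (λ i → f (suc i)) (λ i → g (suc i))))
                        (+-+-interchange (f 0) (g 0) _ _)
  where
  +-+-interchange : ∀ a b c d → a + b + (c + d) ≡ a + c + (b + d)
  +-+-interchange = solve-∀

Σ-*ˡ : ∀ n f c → c * Σ n f ≡ Σ n (λ i → c * f i)
Σ-*ˡ zero    f c = *-zeroʳ c
Σ-*ˡ (suc n) f c = trans (*-distribˡ-+ c (f 0) _) (cong (c * f 0 +_) (Σ-*ˡ n (λ i → f (suc i)) c))

Σ-product : ∀ a b f g → Σ a f * Σ b g ≡ Σ a (λ i → Σ b (λ j → f i * g j))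
Σ-product zero    b f g = refl
Σ-product (suc a) b f g = trans (*-distribʳ-+ (Σ b g) (f 0) _)
  (cong₂ _+_ (Σ-*ˡ b g (f 0)) (Σ-product a b (λ i → f (suc i)) g))

Σ-swap : ∀ a b (F : ℕ → ℕ → ℕ) → Σ a (λ i → Σ b (F i)) ≡ Σ b (λ j → Σ a (λ i → F i j))
Σ-swap zero    b F = sym (Σ-zero b)
Σ-swap (suc a) b F = trans (cong (Σ b (F 0) +_) (Σ-swap a b (λ i → F (suc i))))
                           (sym (Σ-+ b (F 0) (λ j → Σ a (λ i → F (suc i) j))))

term≤Σ : ∀ n f k → k < n → f k ≤ Σ n f
term≤Σ (suc n) f zero    _         = m≤m+n (f 0) _
term≤Σ (suc n) f (suc k) (s≤s k<n) = ≤-trans (term≤Σ n (λ i → f (suc i)) k k<n) (m≤n+m _ (f 0))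

Σ-prefix : ∀ a c f → a ≤ c → Σ a f ≤ Σ c f
Σ-prefix a c f a≤c = begin
  Σ a f                              ≤⟨ m≤m+n _ _ ⟩
  Σ a f + Σ (c ∸ a) (λ i → f (a + i)) ≡⟨ sym (Σ-split a (c ∸ a) f) ⟩
  Σ (a + (c ∸ a)) f                  ≡⟨ cong (λ l → Σ l f) (m+[n∸m]≡n a≤c) ⟩
  Σ c f                              ∎
  where open ≤-Reasoning

Σ-periodic : ∀ k g f → (∀ i → f (g + i) ≡ f i) → Σ (k * g) f ≡ k * Σ g f
Σ-periodic zero    g f periodic = refl
Σ-periodic (suc k) g f periodic = trans (Σ-split g (k * g) f)
  (cong (Σ g f +_) (trans (Σ-cong (k * g) (λ i _ → periodic i)) (Σ-periodic k g f periodic)))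

Σ-rotate : ∀ N .{{_ : NonZero N}} s (F : ℕ → ℕ) → Σ N (λ i → F ((s + i) % N)) ≡ Σ N F
Σ-rotate N           zero    F = Σ-cong N (λ i i<N → cong F (m<n⇒m%n≡m i<N))
Σ-rotate N@(suc N-1) (suc s) F = begin
  Σ N (λ i → F ((suc s + i) % N))                    ≡⟨ Σ-cong N (λ i _ → cong (λ z → F (z % N)) (sym (+-suc s i))) ⟩
  Σ N (λ i → G (suc i))                              ≡⟨ cong (λ l → Σ l (λ i → G (suc i))) (+-comm 1 N-1) ⟩
  Σ (N-1 + 1) (λ i → G (suc i))                      ≡⟨ Σ-split N-1 1 (λ i → G (suc i)) ⟩
  Σ N-1 (λ i → G (suc i)) + (G (suc (N-1 + 0)) + 0)  ≡⟨ cong (Σ N-1 (λ i → G (suc i)) +_) last≡first ⟩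
  Σ N-1 (λ i → G (suc i)) + G 0                      ≡⟨ +-comm _ (G 0) ⟩
  Σ N G                                              ≡⟨ Σ-rotate N s F ⟩
  Σ N F                                              ∎
  where
  open ≡-Reasoning
  G : ℕ → ℕ
  G i = F ((s + i) % N)
  last≡first : G (suc (N-1 + 0)) + 0 ≡ G 0
  last≡first = begin
    G (suc (N-1 + 0)) + 0 ≡⟨ +-identityʳ _ ⟩
    G (suc (N-1 + 0))     ≡⟨ cong (λ l → G (suc l)) (+-identityʳ N-1) ⟩
    F ((s + N) % N)       ≡⟨ cong F ([m+n]%n≡m%n s N) ⟩
    F (s % N)             ≡⟨ cong (λ z → F (z % N)) (sym (+-identityʳ s)) ⟩
    G 0                   ∎

⟦_⟧ : Bool → ℕ
⟦ true  ⟧ = 1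
⟦ false ⟧ = 0

⟦⟧≤1 : ∀ b → ⟦ b ⟧ ≤ 1
⟦⟧≤1 true  = ≤-refl
⟦⟧≤1 false = z≤n

⟦∧⟧ : ∀ a b → ⟦ a ∧ b ⟧ ≡ ⟦ a ⟧ * ⟦ b ⟧
⟦∧⟧ true  b = sym (+-identityʳ ⟦ b ⟧)
⟦∧⟧ false b = refl

δ : ℕ → ℕ → ℕ
δ a b = ⟦ does (a ≟ b) ⟧

δ-refl : ∀ a → δ a a ≡ 1
δ-refl a = cong ⟦_⟧ (dec-true (a ≟ a) refl)

δ-≢ : ∀ {a b} → ¬ a ≡ b → δ a b ≡ 0
δ-≢ {a} {b} a≢b = cong ⟦_⟧ (dec-false (a ≟ b) a≢b)

δ-sym : ∀ a b → δ a b ≡ δ b a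
δ-sym a b with a ≟ b
... | yes refl = refl
... | no a≢b   = trans (δ-≢ a≢b) (sym (δ-≢ (≢-sym a≢b)))

-- Hits of a residue class in a window of consecutive integers

hits : (N : ℕ) .{{_ : NonZero N}} → (s t L : ℕ) → ℕ
hits N s t L = Σ L (λ i → δ ((s + i) % N) (t % N))

hits-full : ∀ N .{{_ : NonZero N}} s t → hits N s t N ≡ 1
hits-full N s t = trans (Σ-rotate N s (λ v → δ v (t % N))) (Σ-δ N (t % N) (m%n<n t N))
  where
  Σ-δ : ∀ k r → r < k → Σ k (λ v → δ v r) ≡ 1
  Σ-δ (suc k) zero    _         = cong suc (Σ-zero k)
  Σ-δ (suc k) (suc r) (s≤s r<k) = Σ-δ k r r<k

hits-≤1 : ∀ N .{{_ : NonZero N}} s t L → L ≤ N → hits N s t L ≤ 1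
hits-≤1 N s t L L≤N =
  subst (hits N s t L ≤_) (hits-full N s t) (Σ-prefix L N (λ i → δ ((s + i) % N) (t % N)) L≤N)

hits-blocks : ∀ g .{{_ : NonZero g}} s t K r → hits g s t (K * g + r) ≡ K + hits g s t r
hits-blocks g s t K r = begin
  Σ (K * g + r) f                         ≡⟨ Σ-split (K * g) r f ⟩
  Σ (K * g) f + Σ r (λ i → f (K * g + i)) ≡⟨ cong₂ _+_ (Σ-periodic K g f periodic) (Σ-cong r (λ i _ → shift K i)) ⟩
  K * hits g s t g + hits g s t r         ≡⟨ cong (λ h → K * h + hits g s t r) (hits-full g s t) ⟩
  K * 1 + hits g s t r                    ≡⟨ cong (_+ hits g s t r) (*-identityʳ K) ⟩
  K + hits g s t r                        ∎
  where
  open ≡-Reasoning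
  f : ℕ → ℕ
  f i = δ ((s + i) % g) (t % g)
  shift : ∀ k i → f (k * g + i) ≡ f i
  shift k i = cong (λ z → δ z (t % g)) (trans (cong (_% g) (reorder s k g i)) ([m+kn]%n≡m%n (s + i) k g))
    where
    reorder : ∀ s k g i → s + (k * g + i) ≡ s + i + k * g
    reorder = solve-∀
  periodic : ∀ i → f (g + i) ≡ f i
  periodic i = trans (cong (λ l → f (l + i)) (sym (+-identityʳ g))) (shift 1 i)

-- Counting pairs (i, j) with c₁ + i ≡ c₂ + j (mod g)

module CongruentPairs (g : ℕ) .{{_ : NonZero g}} (c₁ c₂ : ℕ) where

  congruent : ℕ → ℕ → ℕ
  congruent i j = δ ((c₁ + i) % g) ((c₂ + j) % g)

  row : ∀ i L → Σ L (congruent i) ≡ hits g c₂ (c₁ + i) L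
  row i L = Σ-cong L (λ j _ → δ-sym ((c₁ + i) % g) ((c₂ + j) % g))

  -- Exact count: every row gives B, the last r_B columns give A each, plus the corner D.
  pairs-decomposition : ∀ A rA B rB →
    Σ (A * g + rA) (λ i → Σ (B * g + rB) (congruent i))
      ≡ (A * g + rA) * B + (rB * A + Σ rB (λ j → Σ rA (λ i → congruent i j)))
  pairs-decomposition A rA B rB = begin
    Σ L₁ (λ i → Σ (B * g + rB) (congruent i))       ≡⟨ Σ-cong L₁ (λ i _ → trans (row i (B * g + rB)) (hits-blocks g c₂ (c₁ + i) B rB)) ⟩
    Σ L₁ (λ i → B + hits g c₂ (c₁ + i) rB)          ≡⟨ Σ-+ L₁ (λ _ → B) _ ⟩
    Σ L₁ (λ _ → B) + Σ L₁ (λ i → hits g c₂ (c₁ + i) rB) ≡⟨ cong₂ _+_ (Σ-const L₁ B) (Σ-cong L₁ (λ i _ → sym (row i rB))) ⟩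
    L₁ * B + Σ L₁ (λ i → Σ rB (congruent i))         ≡⟨ cong (L₁ * B +_) (Σ-swap L₁ rB congruent) ⟩
    L₁ * B + Σ rB (λ j → hits g c₁ (c₂ + j) L₁)      ≡⟨ cong (L₁ * B +_) (Σ-cong rB (λ j _ → hits-blocks g c₁ (c₂ + j) A rA)) ⟩
    L₁ * B + Σ rB (λ j → A + hits g c₁ (c₂ + j) rA)  ≡⟨ cong (L₁ * B +_) (Σ-+ rB (λ _ → A) _) ⟩
    L₁ * B + (Σ rB (λ _ → A) + D)                   ≡⟨ cong (λ z → L₁ * B + (z + D)) (Σ-const rB A) ⟩
    L₁ * B + (rB * A + D)                           ∎
    where
    open ≡-Reasoning
    L₁ = A * g + rA
    D = Σ rB (λ j → Σ rA (λ i → congruent i j))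

  -- The r_A × r_B corner holds at least r_A + r_B - g congruent pairs: its
  -- rows, completed to g columns, hold r_A pairs, and the g - r_B completing
  -- columns hold at most one pair each.
  corner-bound : ∀ rA rB → rA ≤ g → rB ≤ g → rA + rB ∸ g ≤ Σ rB (λ j → Σ rA (λ i → congruent i j))
  corner-bound rA rB rA≤g rB≤g =
    subst (rA + rB ∸ g ≤_) (Σ-swap rA rB congruent) (m≤n+o⇒m∸n≤o (rA + rB) g rA+rB≤g+D)
    where
    D = Σ rA (λ i → Σ rB (congruent i))
    outside : ℕ → ℕ
    outside i = Σ (g ∸ rB) (λ j → congruent i (rB + j))
    completedRow : ∀ i → Σ rB (congruent i) + outside i ≡ 1
    completedRow i = begin
      Σ rB (congruent i) + outside i  ≡⟨ sym (Σ-split rB (g ∸ rB) (congruent i)) ⟩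
      Σ (rB + (g ∸ rB)) (congruent i) ≡⟨ cong (λ l → Σ l (congruent i)) (m+[n∸m]≡n rB≤g) ⟩
      Σ g (congruent i)               ≡⟨ trans (row i g) (hits-full g c₂ (c₁ + i)) ⟩
      1                               ∎
      where open ≡-Reasoning
    rows : D + Σ rA outside ≡ rA
    rows = trans (sym (Σ-+ rA (λ i → Σ rB (congruent i)) outside))
      (trans (Σ-cong rA (λ i _ → completedRow i)) (trans (Σ-const rA 1) (*-identityʳ rA)))
    columns : Σ rA outside ≤ g ∸ rB
    columns = begin
      Σ rA outside                                           ≡⟨ Σ-swap rA (g ∸ rB) (λ i j → congruent i (rB + j)) ⟩
      Σ (g ∸ rB) (λ j → hits g c₁ (c₂ + (rB + j)) rA)        ≤⟨ Σ-mono (g ∸ rB) (λ j _ → hits-≤1 g c₁ (c₂ + (rB + j)) rA rA≤g) ⟩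
      Σ (g ∸ rB) (λ _ → 1)                                   ≡⟨ trans (Σ-const (g ∸ rB) 1) (*-identityʳ _) ⟩
      g ∸ rB                                                 ∎
      where open ≤-Reasoning
    rA+rB≤g+D : rA + rB ≤ g + D
    rA+rB≤g+D = begin
      rA + rB                 ≡⟨ cong (_+ rB) (sym rows) ⟩
      D + Σ rA outside + rB   ≤⟨ +-monoˡ-≤ rB (+-monoʳ-≤ D columns) ⟩
      D + (g ∸ rB) + rB       ≡⟨ +-assoc D _ rB ⟩
      D + (g ∸ rB + rB)       ≡⟨ cong (D +_) (m∸n+n≡m rB≤g) ⟩
      D + g                   ≡⟨ +-comm D g ⟩
      g + D                   ∎
      where open ≤-Reasoning

  congruentPairs-lowerBound : ∀ A rA B rB → rA ≤ g → rB ≤ g →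
    A * B * g + A * rB + B * rA + (rA + rB ∸ g) ≤ Σ (A * g + rA) (λ i → Σ (B * g + rB) (congruent i))
  congruentPairs-lowerBound A rA B rB rA≤g rB≤g = begin
    A * B * g + A * rB + B * rA + (rA + rB ∸ g) ≡⟨ regroup A B g rA rB (rA + rB ∸ g) ⟩
    (A * g + rA) * B + (rB * A + (rA + rB ∸ g)) ≤⟨ +-monoʳ-≤ ((A * g + rA) * B) (+-monoʳ-≤ (rB * A) (corner-bound rA rB rA≤g rB≤g)) ⟩
    (A * g + rA) * B + (rB * A + Σ rB (λ j → Σ rA (λ i → congruent i j))) ≡⟨ sym (pairs-decomposition A rA B rB) ⟩
    Σ (A * g + rA) (λ i → Σ (B * g + rB) (congruent i)) ∎
    where
    open ≤-Reasoning
    regroup : ∀ A B g rA rB d → A * B * g + A * rB + B * rA + d ≡ (A * g + rA) * B + (rB * A + d)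
    regroup = solve-∀

open CongruentPairs using (congruent; congruentPairs-lowerBound)

-- The Chinese remainder theorem (existence part)

-- Bézout's identity as a congruence: some multiple k·m is ≡ gcd m n (mod n).
multiple≡gcd : ∀ m n-1 → ∃[ k ] ∃[ s ] ∃[ t ] k * m + suc n-1 * s ≡ gcd m (suc n-1) + suc n-1 * t
multiple≡gcd m n-1 with Bézout.identity (gcd-GCD m (suc n-1))
... | Bézout.+- x y eq = x , 0 , y , trans (cong₂ _+_ (sym eq) (*-zeroʳ (suc n-1)))
       (trans (+-identityʳ _) (cong (gcd m (suc n-1) +_) (*-comm y (suc n-1))))
... | Bézout.-+ x y eq = n-1 * x , y , x * m ,
       trans (cong (n-1 * x * m +_) (trans (*-comm (suc n-1) y) (sym eq))) (regroup n-1 x m (gcd m (suc n-1)))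
  where
  regroup : ∀ n-1 x m g → n-1 * x * m + (g + x * m) ≡ g + suc n-1 * (x * m)
  regroup = solve-∀

lift-congruence : ∀ g .{{_ : NonZero g}} ν u v → u % g ≡ v % g →
  ∃[ q ] ∃[ a ] u + q * g ≡ v + a * (suc ν * g)
lift-congruence g ν u v u≡v = v / g + u / g * ν , u / g , (begin
  u + (β + α * ν) * g                 ≡⟨ cong (_+ (β + α * ν) * g) (m≡m%n+[m/n]*n u g) ⟩
  u % g + α * g + (β + α * ν) * g     ≡⟨ regroup (u % g) α β ν g ⟩
  u % g + β * g + α * (suc ν * g)     ≡⟨ cong (λ r → r + β * g + α * (suc ν * g)) u≡v ⟩
  v % g + β * g + α * (suc ν * g)     ≡⟨ cong (_+ α * (suc ν * g)) (sym (m≡m%n+[m/n]*n v g)) ⟩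
  v + α * (suc ν * g)                 ∎)
  where
  open ≡-Reasoning
  α = u / g
  β = v / g
  regroup : ∀ ρ α β ν g → ρ + α * g + (β + α * ν) * g ≡ ρ + β * g + α * (suc ν * g)
  regroup = solve-∀

crt-solution : ∀ m n .{{_ : NonZero m}} .{{_ : NonZero n}} .{{_ : NonZero (gcd m n)}} u v →
  u % gcd m n ≡ v % gcd m n → ∃[ X ] X % m ≡ u % m × X % n ≡ v % n
crt-solution m n@(suc n-1) u v u≡v with gcd[m,n]∣n m n | multiple≡gcd m n-1
... | divides (suc ν) n≡νg | k , s , t , bezout with lift-congruence (gcd m n) ν u v u≡v
... | q , a , lifted = X , X≡u , X≡v
  where
  X = u + q * (k * m)
  X≡u : X % m ≡ u % m
  X≡u = trans (cong (λ z → (u + z) % m) (sym (*-assoc q k m))) ([m+kn]%n≡m%n u (q * k) m)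
  shifted : X + q * s * n ≡ v + (a + q * t) * n
  shifted = begin
    u + q * (k * m) + q * s * n          ≡⟨ regroup₁ u q k m s n ⟩
    u + q * (k * m + n * s)              ≡⟨ cong (λ z → u + q * z) bezout ⟩
    u + q * (gcd m n + n * t)            ≡⟨ regroup₂ u q (gcd m n) n t ⟩
    u + q * gcd m n + q * t * n          ≡⟨ cong (λ z → z + q * t * n) lifted ⟩
    v + a * (suc ν * gcd m n) + q * t * n ≡⟨ cong (λ z → v + a * z + q * t * n) (sym n≡νg) ⟩
    v + a * n + q * t * n                ≡⟨ regroup₃ v a n q t ⟩
    v + (a + q * t) * n                  ∎
    where
    open ≡-Reasoning
    regroup₁ : ∀ u q k m s n → u + q * (k * m) + q * s * n ≡ u + q * (k * m + n * s)
    regroup₁ = solve-∀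
    regroup₂ : ∀ u q g n t → u + q * (g + n * t) ≡ u + q * g + q * t * n
    regroup₂ = solve-∀
    regroup₃ : ∀ v a n q t → v + a * n + q * t * n ≡ v + (a + q * t) * n
    regroup₃ = solve-∀
  X≡v : X % n ≡ v % n
  X≡v = trans (sym ([m+kn]%n≡m%n X (q * s) n)) (trans (cong (_% n) shifted) ([m+kn]%n≡m%n v (a + q * t) n))

module CommonMultiple (m n : ℕ) .{{_ : NonZero m}} .{{_ : NonZero n}} .{{_ : NonZero (gcd m n)}} where

  M≡m*[n/g] : m * n / gcd m n ≡ m * (n / gcd m n)
  M≡m*[n/g] = *-/-assoc m (gcd[m,n]∣n m n)

  M-nonZero : NonZero (m * n / gcd m n)
  M-nonZero = subst NonZero (sym M≡m*[n/g]) (m*n≢0 m (n / gcd m n))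
    where
    instance
      n/g-nonZero : NonZero (n / gcd m n)
      n/g-nonZero = >-nonZero (m≥n⇒m/n>0 (∣⇒≤ (gcd[m,n]∣n m n)))

  m∣M : m ∣ m * n / gcd m n
  m∣M = subst (m ∣_) (sym M≡m*[n/g]) (m∣m*n (n / gcd m n))

  n∣M : n ∣ m * n / gcd m n
  n∣M = subst (n ∣_) (trans (sym (*-/-assoc n (gcd[m,n]∣m m n))) (cong (_/ gcd m n) (*-comm n m)))
              (m∣m*n (m / gcd m n))

crt : ∀ m n .{{_ : NonZero m}} .{{_ : NonZero n}} .{{_ : NonZero (gcd m n)}} u v →
  u % gcd m n ≡ v % gcd m n → ∃[ x ] x < m * n / gcd m n × x % m ≡ u % m × x % n ≡ v % n
crt m n u v u≡v with crt-solution m n u v u≡v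
... | X , X≡u , X≡v = X % M , m%n<n X M ,
  trans (m∣n⇒o%n%m≡o%m m M X m∣M) X≡u , trans (m∣n⇒o%n%m≡o%m n M X n∣M) X≡v
  where
  open CommonMultiple m n
  instance _ = M-nonZero
  M = m * n / gcd m n

length-filter : ∀ (p : ℕ → Bool) n f →
  length (filter (λ x → T? (p x)) (applyUpTo f n)) ≡ Σ n (λ i → ⟦ p (f i) ⟧)
length-filter p zero    f = refl
length-filter p (suc n) f with p (f 0)
... | true  = cong suc (length-filter p n (λ i → f (suc i)))
... | false = length-filter p n (λ i → f (suc i))

count≤any : ∀ (p : ℕ → Bool) n f →
  Σ n (λ i → ⟦ p (f i) ⟧) ≤ 1 → Σ n (λ i → ⟦ p (f i) ⟧) ≤ ⟦ any p (applyUpTo f n) ⟧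
count≤any p zero    f _  = z≤n
count≤any p (suc n) f ≤1 with p (f 0)
... | true  = ≤1
... | false = count≤any p n (λ i → f (suc i)) ≤1

hits≤inInterval : ∀ m .{{_ : NonZero m}} c L x → L ≤ m → hits m c x L ≤ ⟦ inInterval m c L x ⟧
hits≤inInterval m c L x L≤m = count≤any (λ i → does (((c + i) % m) ≟ (x % m))) L (λ i → i) (hits-≤1 m c x L L≤m)

module _ (m n : ℕ) .{{_ : NonZero m}} .{{_ : NonZero n}} (c₁ L₁ c₂ L₂ : ℕ) where
  private instance _ = gcd-nonZero m n

  solution : ℕ → ℕ
  solution x = ⟦ inInterval m c₁ L₁ x ∧ inInterval n c₂ L₂ x ⟧

  countSolutions-as-sum : countSolutions m n c₁ L₁ c₂ L₂ ≡ Σ (m * n / gcd m n) solution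
  countSolutions-as-sum = length-filter (λ x → inInterval m c₁ L₁ x ∧ inInterval n c₂ L₂ x) (m * n / gcd m n) (λ x → x)

  -- Each congruent pair (i, j) yields a solution x < mn/g of x ≡ c₁+i (mod m), x ≡ c₂+j (mod n),
  -- and distinct pairs count every x at most once since the intervals are short.
  solutions≥congruentPairs : L₁ ≤ m → L₂ ≤ n →
    Σ L₁ (λ i → Σ L₂ (congruent (gcd m n) c₁ c₂ i)) ≤ Σ (m * n / gcd m n) solution
  solutions≥congruentPairs L₁≤m L₂≤n = begin
    Σ L₁ (λ i → Σ L₂ (congruent g c₁ c₂ i))                ≤⟨ Σ-mono L₁ (λ i _ → Σ-mono L₂ (λ j _ → congruent≤witnesses i j)) ⟩
    Σ L₁ (λ i → Σ L₂ (λ j → Σ M (λ x → a x i * b x j)))     ≡⟨ Σ-cong L₁ (λ i _ → Σ-swap L₂ M (λ j x → a x i * b x j)) ⟩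
    Σ L₁ (λ i → Σ M (λ x → Σ L₂ (λ j → a x i * b x j)))     ≡⟨ Σ-swap L₁ M (λ i x → Σ L₂ (λ j → a x i * b x j)) ⟩
    Σ M (λ x → Σ L₁ (λ i → Σ L₂ (λ j → a x i * b x j)))     ≡⟨ Σ-cong M (λ x _ → sym (Σ-product L₁ L₂ (a x) (b x))) ⟩
    Σ M (λ x → hits m c₁ x L₁ * hits n c₂ x L₂)             ≤⟨ Σ-mono M (λ x _ → *-mono-≤ (hits≤inInterval m c₁ L₁ x L₁≤m) (hits≤inInterval n c₂ L₂ x L₂≤n)) ⟩
    Σ M (λ x → ⟦ inInterval m c₁ L₁ x ⟧ * ⟦ inInterval n c₂ L₂ x ⟧) ≡⟨ Σ-cong M (λ x _ → sym (⟦∧⟧ (inInterval m c₁ L₁ x) _)) ⟩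
    Σ M solution                                           ∎
    where
    open ≤-Reasoning
    g = gcd m n
    M = m * n / g
    a : ℕ → ℕ → ℕ
    a x i = δ ((c₁ + i) % m) (x % m)
    b : ℕ → ℕ → ℕ
    b x j = δ ((c₂ + j) % n) (x % n)
    congruent≤witnesses : ∀ i j → congruent g c₁ c₂ i j ≤ Σ M (λ x → a x i * b x j)
    congruent≤witnesses i j with ((c₁ + i) % g) ≟ ((c₂ + j) % g)
    ... | no i≢j = subst (_≤ Σ M (λ x → a x i * b x j)) (sym (δ-≢ i≢j)) z≤n
    ... | yes i≡j with crt m n (c₁ + i) (c₂ + j) i≡j
    ... | x , x<M , x≡i , x≡j = begin
      congruent g c₁ c₂ i j     ≤⟨ ⟦⟧≤1 _ ⟩
      1                         ≡⟨ sym witness ⟩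
      a x i * b x j             ≤⟨ term≤Σ M (λ x → a x i * b x j) x x<M ⟩
      Σ M (λ x → a x i * b x j) ∎
      where
      witness : a x i * b x j ≡ 1
      witness = cong₂ _*_ (trans (cong (λ z → δ z (x % m)) (sym x≡i)) (δ-refl (x % m)))
                          (trans (cong (λ z → δ z (x % n)) (sym x≡j)) (δ-refl (x % n)))

theorem2p2 : (m n : ℕ) .{{_ : NonZero m}} .{{_ : NonZero n}} →
    (c₁ L₁ c₂ L₂ : ℕ) → L₁ ≤ m → L₂ ≤ n →
    (A rA B rB : ℕ) →
    L₁ ≡ A * gcd m n + rA → rA < gcd m n →
    L₂ ≡ B * gcd m n + rB → rB < gcd m n →
    A * B * gcd m n + A * rB + B * rA + (0 ⊔ ((rA + rB) ∸ gcd m n))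
    ≤ countSolutions m n c₁ L₁ c₂ L₂
theorem2p2 m n c₁ L₁ c₂ L₂ L₁≤m L₂≤n A rA B rB refl rA<g refl rB<g = begin
  A * B * g + A * rB + B * rA + (rA + rB ∸ g)      ≤⟨ congruentPairs-lowerBound g c₁ c₂ A rA B rB (<⇒≤ rA<g) (<⇒≤ rB<g) ⟩
  Σ L₁ (λ i → Σ L₂ (congruent g c₁ c₂ i))           ≤⟨ solutions≥congruentPairs m n c₁ L₁ c₂ L₂ L₁≤m L₂≤n ⟩
  Σ (m * n / g) (solution m n c₁ L₁ c₂ L₂)          ≡⟨ sym (countSolutions-as-sum m n c₁ L₁ c₂ L₂) ⟩
  countSolutions m n c₁ L₁ c₂ L₂                    ∎
  where
  open ≤-Reasoning
  instance _ = gcd-nonZero m n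
  g = gcd m n
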